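{- Let $\Lambda$ be a linear order, $\alpha\in|\Lambda|$, let $A$ be any worm, and let $A_1,\dots,A_k\in\mathbb{W}_\alpha$. Then either $\mathsf{GLP}_\Lambda\vdash\langle\alpha\rangle(A\wedge\bigwedge_i\neg A_i)\leftrightarrow\langle\alpha\rangle A$, or $\mathsf{GLP}_\Lambda\vdash(A\wedge\bigwedge_i\neg A_i)\leftrightarrow\bot$ (and hence also $\mathsf{GLP}_\Lambda\vdash\langle\alpha\rangle(A\wedge\bigwedge_i\neg A_i)\leftrightarrow\bot$).
   Context: $\mathsf{GLP}_\Lambda$ is the modal logic with modalities $[\alpha]$, $\alpha\in|\Lambda|$, $\langle\alpha\rangle:=\neg[\alpha]\neg$, axiomatized by propositional tautologies and, for all $\alpha,\beta$: (i) $[\alpha](\chi\to\psi)\to([\alpha]\chi\to[\alpha]\psi)$; (ii) $[\alpha]([\alpha]\chi\to\chi)\to[\alpha]\chi$; (iii) $[\alpha]\chi\to[\beta][\alpha]\chi$ for $\alpha\le\beta$; (iv) $\langle\alpha\rangle\chi\to[\beta]\langle\alpha\rangle\chi$ for $\alpha<\beta$; (v) $[\alpha]\chi\to[\beta]\chi$ for $\alpha\le\beta$; with modus ponens and necessitation. A worm is a formula $\langle\alpha_1\rangle\cdots\langle\alpha_n\rangle\top$ ($n\ge0$); $\mathbb{W}_\alpha$ is the set of worms all of whose modals are $\ge\alpha$. -}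

module Defs where

open import Level using (Level; _⊔_)
open import Data.Nat using (ℕ)
open import Data.Bool using (Bool; true; false; not; _∧_; _∨_)
open import Data.List using (List; []; _∷_; foldr; map)
open import Data.List.Relation.Unary.All using (All)
open import Data.Sum using (_⊎_)
open import Relation.Binary.PropositionalEquality using (_≡_)
open import Relation.Binary.Bundles using (StrictTotalOrder)

module GLP {c ℓ₁ ℓ₂ : Level} (Λ : StrictTotalOrder c ℓ₁ ℓ₂) where
  open StrictTotalOrder Λ renaming (Carrier to Ord)

  _≤ᴸ_ : Ord → Ord → Set (ℓ₁ ⊔ ℓ₂)
  α ≤ᴸ β = (α < β) ⊎ (α ≈ β)

  infixr 5 _⇒_
  infix 4 _⇔_
  infixr 6 _∧ᶠ_
  infix 7 [_]_ ⟨_⟩_ ¬ᶠ_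

  data Form : Set c where
    var : ℕ → Form
    ⊥ᶠ  : Form
    _⇒_ : Form → Form → Form
    [_]_ : Ord → Form → Form

  ¬ᶠ_ : Form → Form
  ¬ᶠ φ = φ ⇒ ⊥ᶠ

  ⊤ᶠ : Form
  ⊤ᶠ = ¬ᶠ ⊥ᶠ

  _∧ᶠ_ : Form → Form → Form
  φ ∧ᶠ ψ = ¬ᶠ (φ ⇒ ¬ᶠ ψ)

  _⇔_ : Form → Form → Form
  φ ⇔ ψ = (φ ⇒ ψ) ∧ᶠ (ψ ⇒ φ)

  ⟨_⟩_ : Ord → Form → Form
  ⟨ α ⟩ φ = ¬ᶠ ([ α ] (¬ᶠ φ))

  ⋀ : List Form → Form
  ⋀ = foldr _∧ᶠ_ ⊤ᶠ

  evalP : (Form → Bool) → Form → Bool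
  evalP v (var n)   = v (var n)
  evalP v ⊥ᶠ        = false
  evalP v (φ ⇒ ψ)   = not (evalP v φ) ∨ evalP v ψ
  evalP v ([ α ] φ) = v ([ α ] φ)

  Tautology : Form → Set c
  Tautology φ = (v : Form → Bool) → evalP v φ ≡ true

  infix 3 ⊢_
  data ⊢_ : Form → Set (c ⊔ ℓ₁ ⊔ ℓ₂) where
    taut : ∀ {φ} → Tautology φ → ⊢ φ
    axK  : ∀ α χ ψ → ⊢ [ α ] (χ ⇒ ψ) ⇒ ([ α ] χ ⇒ [ α ] ψ)
    axL  : ∀ α χ → ⊢ [ α ] ([ α ] χ ⇒ χ) ⇒ [ α ] χ
    ax3  : ∀ {α β} → α ≤ᴸ β → ∀ χ → ⊢ [ α ] χ ⇒ [ β ] ([ α ] χ)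
    ax4  : ∀ {α β} → α < β → ∀ χ → ⊢ ⟨ α ⟩ χ ⇒ [ β ] (⟨ α ⟩ χ)
    ax5  : ∀ {α β} → α ≤ᴸ β → ∀ χ → ⊢ [ α ] χ ⇒ [ β ] χ
    mp   : ∀ {φ ψ} → ⊢ φ ⇒ ψ → ⊢ φ → ⊢ ψ
    nec  : ∀ {φ} α → ⊢ φ → ⊢ [ α ] φ

  -- worms: ⟨α₁⟩⋯⟨αₙ⟩⊤, represented by the list [α₁,…,αₙ]
  Worm : Set c
  Worm = List Ord

  worm : Worm → Form
  worm = foldr ⟨_⟩_ ⊤ᶠ

  InW : Ord → Worm → Set (c ⊔ ℓ₁ ⊔ ℓ₂)
  InW α A = All (α ≤ᴸ_) A

-- Worms are linearly ordered: for worms X and Z, either ⊢ X ↔ Z or one of them proves ⟨d⟩ of the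
-- other, d a letter of either. By induction on total length, factor both worms at their least letter m
-- as X ↔ X₁ ∧ ⟨m⟩X₃ with X₁ strictly above m; comparing each ⟨m⟩-tail with the other whole worm
-- settles the order unless both tails lie below, and then the heads X₁, Z₁ decide.
--
-- Hence for B = ⟨b⟩B' ∈ 𝕎_α either A ⊢ B or A ∧ B ⊢ ⟨α⟩A: cut A and B' where their letters first drop
-- below b, compare the upper parts, and recurse on the lower part of B'. If some Bᵢ follows from A the
-- conjunction A ∧ ⋀¬Bᵢ is refutable; otherwise A ∧ [α]¬A entails every ¬Bᵢ, and the Löb principle
-- ⟨α⟩A → ⟨α⟩(A ∧ [α]¬A) gives ⟨α⟩A → ⟨α⟩(A ∧ ⋀¬Bᵢ).

module Submission where

open import Agda.Builtin.FromNat using (Number; fromNat)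
open import Data.Bool using (Bool; true; false; not; _∨_; _∧_; T)
open import Data.Bool.Properties using (T-∧; T-≡)
open import Data.Empty using (⊥-elim)
open import Data.Fin using (Fin)
open import Data.Fin.Literals using (number)
open import Data.List using (List; []; _∷_; _++_; length; map)
open import Data.List.Membership.Propositional using (_∈_)
open import Data.List.Membership.Propositional.Properties using (∈-++⁻)
open import Data.List.Properties using (length-++-≤ʳ)
open import Data.List.Relation.Unary.All as All using (All; []; _∷_)
open import Data.List.Relation.Unary.All.Properties using (++⁻ˡ; ++⁻ʳ)
open import Data.List.Relation.Unary.Any using (here; there)
import Data.List.Extrema as Extrema
open import Data.Nat as ℕ using (ℕ; zero; suc)
open import Data.Nat.Induction using (<-wellFounded)
import Data.Nat.Properties as ℕₚ
open import Data.Product using (_,_; _×_; proj₁; proj₂; ∃-syntax)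
open import Data.Sum using (_⊎_; inj₁; inj₂; [_,_]′; swap)
open import Data.Unit using (tt)
open import Data.Vec as Vec using (Vec; []; _∷_)
open import Data.Vec.Properties using (lookup-map)
open import Function using (_∘_; id; case_of_; Equivalence)
open import Induction.WellFounded using (Acc; acc)
open import Level using (Level; _⊔_)
open import Relation.Binary.Bundles using (StrictTotalOrder)
open import Relation.Binary.Definitions using (tri<; tri≈; tri>)
open import Relation.Binary.PropositionalEquality using (_≡_; refl; sym; trans; cong₂; subst)

open import Defs

instance
  fin-literals : ∀ {n} → Number (Fin n)
  fin-literals {n} = number n

infixr 5 _⇒ˢ_
infixr 6 _∧ˢ_
infix 7 ¬ˢ_

data Schema (n : ℕ) : Set where
  #_   : Fin n → Schema n
  ⊥ˢ   : Schema n
  _⇒ˢ_ : Schema n → Schema n → Schema n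

¬ˢ_ : ∀ {n} → Schema n → Schema n
¬ˢ φ = φ ⇒ˢ ⊥ˢ

_∧ˢ_ : ∀ {n} → Schema n → Schema n → Schema n
φ ∧ˢ ψ = ¬ˢ (φ ⇒ˢ ¬ˢ ψ)

⟦_⟧ : ∀ {n} → Schema n → Vec Bool n → Bool
⟦ # i ⟧      bs = Vec.lookup bs i
⟦ ⊥ˢ ⟧       bs = false
⟦ φ ⇒ˢ ψ ⟧   bs = not (⟦ φ ⟧ bs) ∨ ⟦ ψ ⟧ bs

valid : ∀ n → (Vec Bool n → Bool) → Bool
valid zero    f = f []
valid (suc n) f = valid n (f ∘ (true ∷_)) ∧ valid n (f ∘ (false ∷_))

valid-sound : ∀ n {f} → T (valid n f) → ∀ bs → T (f bs)
valid-sound zero    ok []           = ok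
valid-sound (suc n) ok (true ∷ bs)  = valid-sound n (proj₁ (Equivalence.to T-∧ ok)) bs
valid-sound (suc n) ok (false ∷ bs) = valid-sound n (proj₂ (Equivalence.to T-∧ ok)) bs

length-head< : ∀ {a} {A : Set a} (xs : List A) {y : A} {ys : List A} →
               length xs ℕ.< length (xs ++ y ∷ ys)
length-head< []       = ℕ.s≤s ℕ.z≤n
length-head< (x ∷ xs) = ℕ.s≤s (length-head< xs)

length-tail< : ∀ {a} {A : Set a} (xs : List A) {y : A} {ys : List A} →
               length ys ℕ.< length (xs ++ y ∷ ys)
length-tail< xs {y} {ys} = length-++-≤ʳ (y ∷ ys) {xs}

module Derivations {c ℓ₁ ℓ₂ : Level} (Λ : StrictTotalOrder c ℓ₁ ℓ₂) where
  open GLP Λ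
  open StrictTotalOrder Λ using (_≈_; _<_; compare; irrefl; <-resp-≈; module Eq)
    renaming (Carrier to Ord; trans to <-trans)
  open import Relation.Binary.Properties.StrictTotalOrder Λ using (totalOrder)
  open import Relation.Binary.Construct.StrictToNonStrict _≈_ _<_ using (<-≤-trans)
  open Extrema totalOrder using (min; min≤⊤; min≤xs; argmin-all)

  _[_] : ∀ {n} → Schema n → Vec Form n → Form
  (# i) [ σ ]    = Vec.lookup σ i
  ⊥ˢ [ σ ]       = ⊥ᶠ
  (φ ⇒ˢ ψ) [ σ ] = φ [ σ ] ⇒ ψ [ σ ]

  evalP-[] : ∀ {n} v (φ : Schema n) σ → evalP v (φ [ σ ]) ≡ ⟦ φ ⟧ (Vec.map (evalP v) σ)
  evalP-[] v (# i)    σ = sym (lookup-map i (evalP v) σ)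
  evalP-[] v ⊥ˢ       σ = refl
  evalP-[] v (φ ⇒ˢ ψ) σ = cong₂ (λ x y → not x ∨ y) (evalP-[] v φ σ) (evalP-[] v ψ σ)

  -- For a valid schema the side condition computes to ⊤, so each use below discharges it with tt;
  -- φ [ σ ] then unfolds definitionally to the intended formula.
  truth-table : ∀ {n} (φ : Schema n) → T (valid n ⟦ φ ⟧) → (σ : Vec Form n) → ⊢ φ [ σ ]
  truth-table φ ok σ =
    taut λ v → trans (evalP-[] v φ σ) (Equivalence.to T-≡ (valid-sound _ ok (Vec.map (evalP v) σ)))

  private variable
    p q r s : Form
    a b d h m m′ m″ : Ord
    H R X X₁ X₃ Z Z₁ Z₃ : Worm

  ⇒-refl : ⊢ p ⇒ p
  ⇒-refl {p} = truth-table (# 0 ⇒ˢ # 0) tt (p ∷ [])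

  ⇒-const : ⊢ p → ⊢ q ⇒ p
  ⇒-const {p} {q} = mp (truth-table (# 0 ⇒ˢ # 1 ⇒ˢ # 0) tt (p ∷ q ∷ []))

  infixr 4 _⨾_

  _⨾_ : ⊢ p ⇒ q → ⊢ q ⇒ r → ⊢ p ⇒ r
  _⨾_ {p} {q} {r} h k =
    mp (mp (truth-table ((# 0 ⇒ˢ # 1) ⇒ˢ (# 1 ⇒ˢ # 2) ⇒ˢ # 0 ⇒ˢ # 2) tt (p ∷ q ∷ r ∷ [])) h) k

  contrapose : ⊢ p ⇒ q → ⊢ ¬ᶠ q ⇒ ¬ᶠ p
  contrapose {p} {q} = mp (truth-table ((# 0 ⇒ˢ # 1) ⇒ˢ ¬ˢ # 1 ⇒ˢ ¬ˢ # 0) tt (p ∷ q ∷ []))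

  ∧-intro : ⊢ p ⇒ q → ⊢ p ⇒ r → ⊢ p ⇒ q ∧ᶠ r
  ∧-intro {p} {q} {r} h k =
    mp (mp (truth-table ((# 0 ⇒ˢ # 1) ⇒ˢ (# 0 ⇒ˢ # 2) ⇒ˢ # 0 ⇒ˢ # 1 ∧ˢ # 2) tt (p ∷ q ∷ r ∷ [])) h) k

  ∧-elimˡ : ⊢ p ∧ᶠ q ⇒ p
  ∧-elimˡ {p} {q} = truth-table (# 0 ∧ˢ # 1 ⇒ˢ # 0) tt (p ∷ q ∷ [])

  ∧-elimʳ : ⊢ p ∧ᶠ q ⇒ q
  ∧-elimʳ {p} {q} = truth-table (# 0 ∧ˢ # 1 ⇒ˢ # 1) tt (p ∷ q ∷ [])

  ⇔-intro : ⊢ p ⇒ q → ⊢ q ⇒ p → ⊢ p ⇔ q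
  ⇔-intro {p} {q} h k =
    mp (mp (truth-table ((# 0 ⇒ˢ # 1) ⇒ˢ (# 1 ⇒ˢ # 0) ⇒ˢ (# 0 ⇒ˢ # 1) ∧ˢ (# 1 ⇒ˢ # 0)) tt
                        (p ∷ q ∷ [])) h) k

  ⊥-intro : ⊢ p ⇒ q → ⊢ p ⇒ ¬ᶠ q → ⊢ p ⇒ ⊥ᶠ
  ⊥-intro {p} {q} h k =
    mp (mp (truth-table ((# 0 ⇒ˢ # 1) ⇒ˢ (# 0 ⇒ˢ ¬ˢ # 1) ⇒ˢ ¬ˢ # 0) tt (p ∷ q ∷ [])) h) k

  ex-falso : ⊢ ⊥ᶠ ⇒ p
  ex-falso {p} = truth-table (⊥ˢ ⇒ˢ # 0) tt (p ∷ [])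

  ⊢⊤ : ⊢ ⊤ᶠ
  ⊢⊤ = taut λ _ → refl

  ∧-contrapose : ⊢ p ∧ᶠ q ⇒ ¬ᶠ r → ⊢ p ∧ᶠ r ⇒ ¬ᶠ q
  ∧-contrapose {p} {q} {r} =
    mp (truth-table ((# 0 ∧ˢ # 1 ⇒ˢ ¬ˢ # 2) ⇒ˢ # 0 ∧ˢ # 2 ⇒ˢ ¬ˢ # 1) tt (p ∷ q ∷ r ∷ []))

  ¬∧-curry : ⊢ ¬ᶠ (p ∧ᶠ q) ⇒ q ⇒ ¬ᶠ p
  ¬∧-curry {p} {q} = truth-table (¬ˢ (# 0 ∧ˢ # 1) ⇒ˢ # 1 ⇒ˢ ¬ˢ # 0) tt (p ∷ q ∷ [])

  ⇒-tollens : ⊢ p ⇒ q ⇒ r → ⊢ s ⇒ q → ⊢ ¬ᶠ r ∧ᶠ s ⇒ ¬ᶠ p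
  ⇒-tollens {p} {q} {r} {s} h k =
    mp (mp (truth-table ((# 0 ⇒ˢ # 1 ⇒ˢ # 2) ⇒ˢ (# 3 ⇒ˢ # 1) ⇒ˢ ¬ˢ # 2 ∧ˢ # 3 ⇒ˢ ¬ˢ # 0) tt
                        (p ∷ q ∷ r ∷ s ∷ [])) h) k

  □-mono : ⊢ p ⇒ q → ⊢ [ a ] p ⇒ [ a ] q
  □-mono {p} {q} {a} h = mp (axK a p q) (nec a h)

  ◇-mono : ⊢ p ⇒ q → ⊢ ⟨ a ⟩ p ⇒ ⟨ a ⟩ q
  ◇-mono h = contrapose (□-mono (contrapose h))

  ◇-antitone : b ≤ᴸ a → ⊢ ⟨ a ⟩ p ⇒ ⟨ b ⟩ p
  ◇-antitone {p = p} b≤a = contrapose (ax5 b≤a (¬ᶠ p))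

  ◇-absorb : b ≤ᴸ a → ⊢ ⟨ a ⟩ ⟨ b ⟩ p ⇒ ⟨ b ⟩ p
  ◇-absorb {b} {a} {p} b≤a =
    contrapose (ax3 b≤a (¬ᶠ p) ⨾ □-mono (truth-table (# 0 ⇒ˢ ¬ˢ ¬ˢ # 0) tt ([ b ] (¬ᶠ p) ∷ [])))

  ◇-transitive : ⊢ ⟨ a ⟩ ⟨ a ⟩ p ⇒ ⟨ a ⟩ p
  ◇-transitive = ◇-absorb (inj₂ Eq.refl)

  ◇-∧-stable : ⊢ r ⇒ [ a ] r → ⊢ ⟨ a ⟩ p ∧ᶠ r ⇒ ⟨ a ⟩ (p ∧ᶠ r)
  ◇-∧-stable {r} {a} {p} = ⇒-tollens (□-mono ¬∧-curry ⨾ axK a r (¬ᶠ p))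

  ◇-löb : ⊢ ⟨ a ⟩ p ⇒ ⟨ a ⟩ (p ∧ᶠ [ a ] (¬ᶠ p))
  ◇-löb {a} {p} = contrapose (□-mono ¬∧-curry ⨾ axL a (¬ᶠ p))

  ≤ᴸ⊎> : ∀ a b → a ≤ᴸ b ⊎ b < a
  ≤ᴸ⊎> a b with compare a b
  ... | tri< a<b _ _ = inj₁ (inj₁ a<b)
  ... | tri≈ _ a≈b _ = inj₁ (inj₂ a≈b)
  ... | tri> _ _ b<a = inj₂ b<a

  least-letter : ∀ x xs → ∃[ m ] m ∈ x ∷ xs × All (m ≤ᴸ_) (x ∷ xs)
  least-letter x xs =
    min x xs , argmin-all id (here refl) (All.tabulate there) , min≤⊤ x xs ∷ min≤xs x xs

  infix 4 _◁_ _▷_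

  data _◁_ : Worm → Ord → Set (c ⊔ ℓ₂) where
    ◁[] : [] ◁ h
    ◁∷  : d < h → (d ∷ R) ◁ h

  _▷_ : Worm → Worm → Set (c ⊔ ℓ₂)
  H ▷ R = All (R ◁_) H

  ◁-weaken : R ◁ b → b ≤ᴸ h → R ◁ h
  ◁-weaken ◁[]      _   = ◁[]
  ◁-weaken (◁∷ d<b) b≤h = ◁∷ (<-≤-trans <-trans (proj₁ <-resp-≈) d<b b≤h)

  ◁-stable : R ◁ h → ⊢ worm R ⇒ [ h ] worm R
  ◁-stable {h = h} ◁[]      = ⇒-const (nec h ⊢⊤)
  ◁-stable {d ∷ R} (◁∷ d<h) = ax4 d<h (worm R)

  ◁-absorb : R ◁ h → ⊢ ⟨ h ⟩ worm R ⇒ worm R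
  ◁-absorb ◁[]      = ⇒-const ⊢⊤
  ◁-absorb (◁∷ d<h) = ◇-absorb (inj₁ d<h)

  worm-++⇒ˡ : ∀ H → ⊢ worm (H ++ R) ⇒ worm H
  worm-++⇒ˡ []      = ⇒-const ⊢⊤
  worm-++⇒ˡ (h ∷ H) = ◇-mono (worm-++⇒ˡ H)

  worm-++⇒ʳ : H ▷ R → ⊢ worm (H ++ R) ⇒ worm R
  worm-++⇒ʳ []          = ⇒-refl
  worm-++⇒ʳ (R◁h ∷ H▷R) = ◇-mono (worm-++⇒ʳ H▷R) ⨾ ◁-absorb R◁h

  worm-++⇐ : H ▷ R → ⊢ worm H ∧ᶠ worm R ⇒ worm (H ++ R)
  worm-++⇐ []          = ∧-elimʳ
  worm-++⇐ (R◁h ∷ H▷R) = ◇-∧-stable (◁-stable R◁h) ⨾ ◇-mono (worm-++⇐ H▷R)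

  data Cut (b : Ord) : Worm → Set (c ⊔ ℓ₁ ⊔ ℓ₂) where
    cut : All (b ≤ᴸ_) H → R ◁ b → Cut b (H ++ R)

  cut-at : ∀ b A → Cut b A
  cut-at b []      = cut [] ◁[]
  cut-at b (x ∷ A) with ≤ᴸ⊎> b x
  ... | inj₂ x<b = cut [] (◁∷ x<b)
  ... | inj₁ b≤x with cut-at b A
  ...   | cut H≥b R◁b = cut (b≤x ∷ H≥b) R◁b

  ▷-cut : All (b ≤ᴸ_) H → R ◁ b → (b ∷ H) ▷ R
  ▷-cut H≥b R◁b = R◁b ∷ All.map (◁-weaken R◁b) H≥b

  data Factor (m : Ord) : Worm → Set (c ⊔ ℓ₁ ⊔ ℓ₂) where
    strict : All (m <_) X → Factor m X
    at     : All (m <_) X₁ → m ≈ m′ → All (m ≤ᴸ_) X₃ → Factor m (X₁ ++ m′ ∷ X₃)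

  factor : All (m ≤ᴸ_) X → Factor m X
  factor []               = strict []
  factor (inj₂ m≈x ∷ m≤X) = at [] m≈x m≤X
  factor (inj₁ m<x ∷ m≤X) with factor m≤X
  ... | strict m<X        = strict (m<x ∷ m<X)
  ... | at m<X₁ m≈m′ m≤X₃ = at (m<x ∷ m<X₁) m≈m′ m≤X₃

  ▷-factor : All (m <_) X₁ → m ≈ m′ → X₁ ▷ m′ ∷ X₃
  ▷-factor m<X₁ m≈m′ = All.map (λ m<h → ◁∷ (proj₂ <-resp-≈ m≈m′ m<h)) m<X₁

  factor⇒tail : All (m <_) X₁ → m ≈ m′ → ⊢ worm (X₁ ++ m′ ∷ X₃) ⇒ ⟨ m ⟩ worm X₃
  factor⇒tail m<X₁ m≈m′ = worm-++⇒ʳ (▷-factor m<X₁ m≈m′) ⨾ ◇-antitone (inj₂ m≈m′)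

  factor-intro : All (m <_) X₁ → m ≈ m′ →
                 ⊢ p ⇒ worm X₁ → ⊢ p ⇒ ⟨ m ⟩ worm X₃ → ⊢ p ⇒ worm (X₁ ++ m′ ∷ X₃)
  factor-intro m<X₁ m≈m′ h k =
    ∧-intro h (k ⨾ ◇-antitone (inj₂ (Eq.sym m≈m′))) ⨾ worm-++⇐ (▷-factor m<X₁ m≈m′)

  factor-intro◇ : All (m <_) X₁ → m ≈ m′ → m < d →
                  ⊢ p ⇒ ⟨ d ⟩ worm X₁ → ⊢ p ⇒ ⟨ m ⟩ worm X₃ → ⊢ p ⇒ ⟨ m ⟩ worm (X₁ ++ m′ ∷ X₃)
  factor-intro◇ m<X₁ m≈m′ m<d h k =
    factor-intro (m<d ∷ m<X₁) m≈m′ h k ⨾ ◇-antitone (inj₁ m<d)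

  data Comparison (X Z : Worm) : Set (c ⊔ ℓ₁ ⊔ ℓ₂) where
    above : ∀ d → d ∈ X ⊎ d ∈ Z → ⊢ worm X ⇒ ⟨ d ⟩ worm Z → Comparison X Z
    equiv : ⊢ worm X ⇒ worm Z → ⊢ worm Z ⇒ worm X → Comparison X Z
    below : ∀ d → d ∈ X ⊎ d ∈ Z → ⊢ worm Z ⇒ ⟨ d ⟩ worm X → Comparison X Z

  flip : Comparison X Z → Comparison Z X
  flip (above d d∈ h) = below d (swap d∈) h
  flip (equiv h k)    = equiv k h
  flip (below d d∈ h) = above d (swap d∈) h

  letter-bound : ∀ {ℓ} {P : Ord → Set ℓ} → All P X → All P Z → d ∈ X ⊎ d ∈ Z → P d
  letter-bound P[X] P[Z] = [ All.lookup P[X] , All.lookup P[Z] ]′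

  comparison-◇ : All (m ≤ᴸ_) X → All (m ≤ᴸ_) Z → Comparison X Z →
                 (⊢ ⟨ m ⟩ worm X ⇒ ⟨ m ⟩ worm Z) ⊎ (⊢ worm Z ⇒ ⟨ m ⟩ worm X)
  comparison-◇ m≤X m≤Z (above d d∈ h) =
    inj₁ (◇-mono (h ⨾ ◇-antitone (letter-bound m≤X m≤Z d∈)) ⨾ ◇-transitive)
  comparison-◇ m≤X m≤Z (equiv h _)    = inj₁ (◇-mono h)
  comparison-◇ m≤X m≤Z (below d d∈ h) = inj₂ (h ⨾ ◇-antitone (letter-bound m≤X m≤Z d∈))

  ComparisonsBelow : ℕ → Set (c ⊔ ℓ₁ ⊔ ℓ₂)
  ComparisonsBelow n = ∀ Y W → length Y ℕ.+ length W ℕ.< n → Comparison Y W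

  compare-factor-strict : let X = X₁ ++ m′ ∷ X₃ in
    m ∈ X ⊎ m ∈ Z → All (m <_) X₁ → m ≈ m′ → All (m ≤ᴸ_) X₃ → All (m <_) Z →
    ComparisonsBelow (length X ℕ.+ length Z) → Comparison X Z
  compare-factor-strict {X₁} {Z = Z} m∈ m<X₁ m≈m′ m≤X₃ m<Z ih
    with comparison-◇ m≤X₃ (All.map inj₁ m<Z) (ih _ Z (ℕₚ.+-monoˡ-< (length Z) (length-tail< X₁)))
  ... | inj₁ ◇X₃⇒◇Z = above _ m∈ (factor⇒tail m<X₁ m≈m′ ⨾ ◇X₃⇒◇Z)
  ... | inj₂ Z⇒◇X₃ with ih X₁ Z (ℕₚ.+-monoˡ-< (length Z) (length-head< X₁))
  ...   | above d d∈ h =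
    above _ m∈ (worm-++⇒ˡ X₁ ⨾ h ⨾ ◇-antitone (inj₁ (letter-bound m<X₁ m<Z d∈)))
  ...   | equiv h k    = equiv (worm-++⇒ˡ X₁ ⨾ h) (factor-intro m<X₁ m≈m′ k Z⇒◇X₃)
  ...   | below d d∈ h = below _ m∈ (factor-intro◇ m<X₁ m≈m′ (letter-bound m<X₁ m<Z d∈) h Z⇒◇X₃)

  compare-factors : let X = X₁ ++ m′ ∷ X₃; Z = Z₁ ++ m″ ∷ Z₃ in
    m ∈ X ⊎ m ∈ Z → All (m ≤ᴸ_) X → All (m ≤ᴸ_) Z →
    All (m <_) X₁ → m ≈ m′ → All (m ≤ᴸ_) X₃ → All (m <_) Z₁ → m ≈ m″ → All (m ≤ᴸ_) Z₃ →
    ComparisonsBelow (length X ℕ.+ length Z) → Comparison X Z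
  compare-factors {X₁} {m′} {X₃} {Z₁} {m″} {Z₃} m∈ m≤X m≤Z m<X₁ m≈m′ m≤X₃ m<Z₁ m≈m″ m≤Z₃ ih
    with comparison-◇ m≤Z₃ m≤X (flip (ih _ Z₃ (ℕₚ.+-monoʳ-< _ (length-tail< Z₁))))
  ... | inj₁ ◇Z₃⇒◇X = below _ m∈ (factor⇒tail m<Z₁ m≈m″ ⨾ ◇Z₃⇒◇X)
  ... | inj₂ X⇒◇Z₃ with comparison-◇ m≤X₃ m≤Z (ih X₃ _ (ℕₚ.+-monoˡ-< _ (length-tail< X₁)))
  ...   | inj₁ ◇X₃⇒◇Z = above _ m∈ (factor⇒tail m<X₁ m≈m′ ⨾ ◇X₃⇒◇Z)
  ...   | inj₂ Z⇒◇X₃ with ih X₁ Z₁ (ℕₚ.+-mono-< (length-head< X₁) (length-head< Z₁))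
  ...     | above d d∈ h = above _ m∈
    (factor-intro◇ m<Z₁ m≈m″ (letter-bound m<X₁ m<Z₁ d∈) (worm-++⇒ˡ X₁ ⨾ h) X⇒◇Z₃)
  ...     | equiv h k = equiv
    (factor-intro m<Z₁ m≈m″ (worm-++⇒ˡ X₁ ⨾ h) X⇒◇Z₃)
    (factor-intro m<X₁ m≈m′ (worm-++⇒ˡ Z₁ ⨾ k) Z⇒◇X₃)
  ...     | below d d∈ h = below _ m∈
    (factor-intro◇ m<X₁ m≈m′ (letter-bound m<X₁ m<Z₁ d∈) (worm-++⇒ˡ Z₁ ⨾ h) Z⇒◇X₃)

  compare-at-minimum : m ∈ X ⊎ m ∈ Z → All (m ≤ᴸ_) X → All (m ≤ᴸ_) Z →
                       ComparisonsBelow (length X ℕ.+ length Z) → Comparison X Z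
  compare-at-minimum {X = X} {Z = Z} m∈ m≤X m≤Z ih with factor m≤X | factor m≤Z
  ... | strict m<X | strict m<Z = ⊥-elim (irrefl Eq.refl (letter-bound m<X m<Z m∈))
  ... | at m<X₁ m≈m′ m≤X₃ | strict m<Z = compare-factor-strict m∈ m<X₁ m≈m′ m≤X₃ m<Z ih
  ... | strict m<X | at m<Z₁ m≈m″ m≤Z₃ = flip (compare-factor-strict (swap m∈) m<Z₁ m≈m″ m≤Z₃ m<X
    (subst ComparisonsBelow (ℕₚ.+-comm (length X) (length Z)) ih))
  ... | at m<X₁ m≈m′ m≤X₃ | at m<Z₁ m≈m″ m≤Z₃ =
    compare-factors m∈ m≤X m≤Z m<X₁ m≈m′ m≤X₃ m<Z₁ m≈m″ m≤Z₃ ih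

  comparison-step : ∀ X Z → ComparisonsBelow (length X ℕ.+ length Z) → Comparison X Z
  comparison-step []      []      _  = equiv ⇒-refl ⇒-refl
  comparison-step []      (z ∷ Z) ih with least-letter z Z
  ... | m , m∈ , m≤Z = compare-at-minimum (inj₂ m∈) [] m≤Z ih
  comparison-step (x ∷ X) Z       ih with least-letter x (X ++ Z)
  ... | m , m∈ , m≤XZ =
    compare-at-minimum (∈-++⁻ (x ∷ X) m∈) (++⁻ˡ (x ∷ X) m≤XZ) (++⁻ʳ (x ∷ X) m≤XZ) ih

  comparison : ∀ X Z → Comparison X Z
  comparison X Z = go X Z (<-wellFounded _)
    where
      go : ∀ X Z → Acc ℕ._<_ (length X ℕ.+ length Z) → Comparison X Z
      go X Z (acc rec) = comparison-step X Z λ Y W lt → go Y W (rec lt)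

  module _ (α : Ord) where

    entails-or-◇ : ∀ A B → All (α ≤ᴸ_) B →
                   (⊢ worm A ⇒ worm B) ⊎ (⊢ worm A ∧ᶠ worm B ⇒ ⟨ α ⟩ worm A)
    entails-or-◇ A B α≤B = go A B α≤B (<-wellFounded _)
      where
        go : ∀ A B → All (α ≤ᴸ_) B → Acc ℕ._<_ (length B) →
             (⊢ worm A ⇒ worm B) ⊎ (⊢ worm A ∧ᶠ worm B ⇒ ⟨ α ⟩ worm A)
        go A []      _           _         = inj₁ (⇒-const ⊢⊤)
        go A (b ∷ B) (α≤b ∷ α≤B) (acc rec) with cut-at b A | cut-at b B
        ... | cut {HA} {RA} HA≥b RA◁b | cut {HB} {RB} HB≥b RB◁b
          with comparison-◇ HB≥b HA≥b (comparison HB HA)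
        ... | inj₁ ◇HB⇒◇HA =
          inj₂ (∧-intro A∧B⇒◇HA A∧B⇒RA ⨾ worm-++⇐ (▷-cut HA≥b RA◁b) ⨾ ◇-antitone α≤b)
          where
            A∧B⇒◇HA : ⊢ worm (HA ++ RA) ∧ᶠ worm (b ∷ HB ++ RB) ⇒ ⟨ b ⟩ worm HA
            A∧B⇒◇HA = ∧-elimʳ ⨾ ◇-mono (worm-++⇒ˡ HB) ⨾ ◇HB⇒◇HA
            A∧B⇒RA : ⊢ worm (HA ++ RA) ∧ᶠ worm (b ∷ HB ++ RB) ⇒ worm RA
            A∧B⇒RA = ∧-elimˡ ⨾ worm-++⇒ʳ (All.tail (▷-cut HA≥b RA◁b))
        ... | inj₂ HA⇒◇HB
          with go (HA ++ RA) RB (++⁻ʳ HB α≤B) (rec (ℕ.s≤s (length-++-≤ʳ RB {HB})))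
        ...   | inj₁ A⇒RB    =
          inj₁ (∧-intro (worm-++⇒ˡ HA ⨾ HA⇒◇HB) A⇒RB ⨾ worm-++⇐ (▷-cut HB≥b RB◁b))
        ...   | inj₂ A∧RB⇒◇A =
          inj₂ (∧-intro ∧-elimˡ (∧-elimʳ ⨾ worm-++⇒ʳ (▷-cut HB≥b RB◁b)) ⨾ A∧RB⇒◇A)

    negations : List Worm → Form
    negations Bs = ⋀ (map (λ B → ¬ᶠ worm B) Bs)

    refuted-or-entailed : ∀ A Bs → All (InW α) Bs →
      (⊢ worm A ∧ᶠ negations Bs ⇒ ⊥ᶠ) ⊎ (⊢ worm A ∧ᶠ [ α ] (¬ᶠ worm A) ⇒ negations Bs)
    refuted-or-entailed A []       _            = inj₂ (⇒-const ⊢⊤)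
    refuted-or-entailed A (B ∷ Bs) (α≤B ∷ α≤Bs)
      with entails-or-◇ A B α≤B | refuted-or-entailed A Bs α≤Bs
    ... | inj₁ A⇒B    | _             = inj₁ (⊥-intro (∧-elimˡ ⨾ A⇒B) (∧-elimʳ ⨾ ∧-elimˡ))
    ... | inj₂ _      | inj₁ refuted  = inj₁ (∧-intro ∧-elimˡ (∧-elimʳ ⨾ ∧-elimʳ) ⨾ refuted)
    ... | inj₂ A∧B⇒◇A | inj₂ entailed = inj₂ (∧-intro (∧-contrapose A∧B⇒◇A) entailed)

mainTheorem18 : ∀ {c ℓ₁ ℓ₂ : Level} (Λ : StrictTotalOrder c ℓ₁ ℓ₂)
    → let open GLP Λ in
      (α : StrictTotalOrder.Carrier Λ) (A : Worm) (As : List Worm) → All (InW α) As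
    → (⊢ ⟨ α ⟩ (worm A ∧ᶠ ⋀ (map (λ B → ¬ᶠ worm B) As)) ⇔ ⟨ α ⟩ worm A)
      ⊎ (⊢ (worm A ∧ᶠ ⋀ (map (λ B → ¬ᶠ worm B) As)) ⇔ ⊥ᶠ)
mainTheorem18 Λ α A As α≤As = case refuted-or-entailed α A As α≤As of λ where
    (inj₁ refuted)  → inj₂ (⇔-intro refuted ex-falso)
    (inj₂ entailed) → inj₁ (⇔-intro (◇-mono ∧-elimˡ) (◇-löb ⨾ ◇-mono (∧-intro ∧-elimˡ entailed)))
  where open Derivations Λ
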